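{- Let $\mathbb{N}=\{1,2,3,\dots\}$ and let $\mathsf{C}=(\mathbb{N},r,\mathbb{N})$ be the Chu space over $\Sigma$ with $r(a,x)=1$ if $a\le x$ and $r(a,x)=0$ otherwise. Then $\mathsf{C}$ is not bifinite.
   Context: $\Sigma$ is a set containing at least two distinct elements, denoted $0$ and $1$. A Chu space over $\Sigma$ is a triple $(A,r,X)$ with sets $A,X$ and a function $r:A\times X\to\Sigma$. A morphism $\varphi=(\varphi^+,\varphi^-):(A,r,X)\to(B,s,Y)$ consists of functions $\varphi^+:A\to B$, $\varphi^-:Y\to X$ with $s(\varphi^+(a),y)=r(a,\varphi^-(y))$ for all $a,y$; composition is $\varphi_2\circ\varphi_1=(\varphi_2^+\circ\varphi_1^+,\varphi_1^-\circ\varphi_2^-)$. $(A,r,X)$ is extensional if for $x,y\in X$, $r(-,x)=r(-,y)$ implies $x=y$. $\mathbf{C}$ is the category of all Chu spaces over $\Sigma$, $\mathbf{E}$ its full subcategory of extensional spaces; $\mathbf{iC}$ (resp. $\mathbf{iE}$) is the subcategory of $\mathbf{C}$ (resp. $\mathbf{E}$) with the same objects whose morphisms are the monomorphisms of $\mathbf{C}$ (resp. $\mathbf{E}$). For such a category $\mathbf{K}$: an $\omega$-sequence in $\mathbf{K}$ is a family of objects $\mathsf{C}_i$ and $\mathbf{K}$-morphisms $\varphi_i:\mathsf{C}_i\to\mathsf{C}_{i+1}$ ($i\ge1$); a cocone is a family of $\mathbf{K}$-morphisms $\psi_i:\mathsf{C}_i\to\mathsf{C}$ with $\psi_{i+1}\circ\varphi_i=\psi_i$;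 it is a colimit in $\mathbf{K}$ if every other cocone $(\psi'_i:\mathsf{C}_i\to\mathsf{C}')$ in $\mathbf{K}$ factors as $\psi'_i=\psi\circ\psi_i$ through a unique $\mathbf{K}$-morphism $\psi$; an object $\mathsf{F}$ is a finite object of $\mathbf{K}$ if for every $\omega$-sequence in $\mathbf{K}$ with a colimit $(\psi_i:\mathsf{C}_i\to\mathsf{C})$ in $\mathbf{K}$ and every $\mathbf{K}$-morphism $\varphi:\mathsf{F}\to\mathsf{C}$ there are $i\ge1$ and a $\mathbf{K}$-morphism $\psi:\mathsf{F}\to\mathsf{C}_i$ with $\varphi=\psi_i\circ\psi$. A Chu space $\mathsf{F}=(A,r,X)$ is strongly finite if it is a finite object of $\mathbf{iC}$, $A$ and $X$ are finite, and $X\neq\emptyset$. A Chu space is bifinite if it is isomorphic to the colimit in $\mathbf{iE}$ of an $\omega$-sequence in $\mathbf{iC}$ all of whose objects are strongly finite. -}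

module Defs where

open import Data.Nat using (ℕ; suc; _≤?_)
open import Data.Fin using (Fin)
open import Data.Product using (Σ; Σ-syntax; _×_)
open import Data.Bool using (if_then_else_)
open import Relation.Nullary using (¬_; does)
open import Relation.Binary.PropositionalEquality using (_≡_; refl; trans; cong)
open import Function.Bundles using (_↔_)

module ChuTheory (Sig : Set) where

  record Chu : Set₁ where
    constructor chu
    field
      Pt : Set
      St : Set
      r  : Pt → St → Sig

  open Chu public

  record Hom (C D : Chu) : Set where
    constructor hom
    field
      f⁺  : Pt C → Pt D
      f⁻  : St D → St C
      adj : ∀ a y → r D (f⁺ a) y ≡ r C a (f⁻ y)

  open Hom public

  _≈ₕ_ : {C D : Chu} → Hom C D → Hom C D → Set
  φ ≈ₕ ψ = (∀ a → f⁺ φ a ≡ f⁺ ψ a) × (∀ y → f⁻ φ y ≡ f⁻ ψ y)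

  idH : (C : Chu) → Hom C C
  idH C = hom (λ a → a) (λ y → y) (λ a y → refl)

  _∘H_ : {C D E : Chu} → Hom D E → Hom C D → Hom C E
  φ₂ ∘H φ₁ = hom (λ a → f⁺ φ₂ (f⁺ φ₁ a)) (λ y → f⁻ φ₁ (f⁻ φ₂ y))
                 (λ a y → trans (adj φ₂ (f⁺ φ₁ a) y) (adj φ₁ a (f⁻ φ₂ y)))

  Extensional : Chu → Set
  Extensional C = ∀ (x y : St C) → (∀ a → r C a x ≡ r C a y) → x ≡ y

  MonoC : {C D : Chu} → Hom C D → Set₁
  MonoC {C} φ = ∀ (B : Chu) (g h : Hom B C) → (φ ∘H g) ≈ₕ (φ ∘H h) → g ≈ₕ h

  MonoE : {C D : Chu} → Hom C D → Set₁
  MonoE {C} φ = ∀ (B : Chu) → Extensional B → (g h : Hom B C) →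
                (φ ∘H g) ≈ₕ (φ ∘H h) → g ≈ₕ h

  record Cat : Set₂ where
    field
      Ob  : Chu → Set₁
      Mor : {C D : Chu} → Hom C D → Set₁

  open Cat public

  record Lift₁ (P : Set) : Set₁ where
    constructor lift₁
    field lower₁ : P

  record ⊤₁ : Set₁ where
    constructor tt₁

  catC catE catiC catiE : Cat
  catC  = record { Ob = λ _ → ⊤₁ ; Mor = λ _ → ⊤₁ }
  catE  = record { Ob = λ C → Lift₁ (Extensional C) ; Mor = λ _ → ⊤₁ }
  catiC = record { Ob = λ _ → ⊤₁ ; Mor = MonoC }
  catiE = record { Ob = λ C → Lift₁ (Extensional C) ; Mor = MonoE }

  -- ω-sequences (index i ∈ ℕ = {0,1,..} corresponds to the paper's i+1)
  record Seq : Set₁ where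
    field
      obj : ℕ → Chu
      map : ∀ i → Hom (obj i) (obj (suc i))

  open Seq public

  SeqIn : Cat → Seq → Set₁
  SeqIn K S = (∀ i → Ob K (obj S i)) × (∀ i → Mor K (map S i))

  record Cocone (S : Seq) : Set₁ where
    field
      apex : Chu
      leg  : ∀ i → Hom (obj S i) apex
      comm : ∀ i → (leg (suc i) ∘H map S i) ≈ₕ leg i

  open Cocone public

  CoconeIn : (K : Cat) {S : Seq} → Cocone S → Set₁
  CoconeIn K c = Ob K (apex c) × (∀ i → Mor K (leg c i))

  IsColimit : (K : Cat) (S : Seq) → Cocone S → Set₁
  IsColimit K S c =
    SeqIn K S × CoconeIn K c ×
    (∀ (c' : Cocone S) → CoconeIn K c' →
       Σ[ u ∈ Hom (apex c) (apex c') ]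
         (Mor K u × (∀ i → (u ∘H leg c i) ≈ₕ leg c' i) ×
          (∀ (v : Hom (apex c) (apex c')) → Mor K v →
             (∀ i → (v ∘H leg c i) ≈ₕ leg c' i) → v ≈ₕ u)))

  FiniteObj : Cat → Chu → Set₁
  FiniteObj K F =
    Ob K F ×
    (∀ (S : Seq) (c : Cocone S) → IsColimit K S c →
       (φ : Hom F (apex c)) → Mor K φ →
       Σ[ i ∈ ℕ ] Σ[ ψ ∈ Hom F (obj S i) ] (Mor K ψ × φ ≈ₕ (leg c i ∘H ψ)))

  FiniteSet : Set → Set
  FiniteSet A = Σ[ n ∈ ℕ ] (Fin n ↔ A)

  StronglyFinite : Chu → Set₁
  StronglyFinite F = FiniteObj catiC F × FiniteSet (Pt F) × FiniteSet (St F) × St F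

  Iso : Chu → Chu → Set
  Iso C D = Σ[ f ∈ Hom C D ] Σ[ g ∈ Hom D C ]
              ((g ∘H f) ≈ₕ idH C × (f ∘H g) ≈ₕ idH D)

  Bifinite : Chu → Set₁
  Bifinite C = Σ[ S ∈ Seq ]
    ((∀ i → StronglyFinite (obj S i)) × SeqIn catiC S ×
     Σ[ c ∈ Cocone S ] (IsColimit catiE S c × Iso C (apex c)))

-- the Chu space (ℕ, ≤, ℕ): r a x = 1 if a ≤ x, else 0
-- (ℕ here starts at 0; order-isomorphic to the paper's {1,2,...})
leqChu : (Sig : Set) (𝟘 𝟙 : Sig) → ChuTheory.Chu Sig
leqChu Sig 𝟘 𝟙 = ChuTheory.chu ℕ ℕ (λ a x → if does (a ≤? x) then 𝟙 else 𝟘)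

module Submission where

-- A state on which every point evaluates to 1 is a "top" state.  Morphisms pull top
-- states back, and in an extensional space a top state is unique.  Each strongly finite
-- stage of a presentation of C = (ℕ, ≤, ℕ) has a top state: its finitely many points land
-- below some n in C, and n pulls back to a top state of the stage.  C itself has none
-- (a + 1 ≰ a), hence neither has the colimit, which receives a morphism from C.  Yet
-- adjoining a fresh top state to the colimit keeps it extensional, and sending it to
-- the top states of the stages gives a cocone of monomorphisms; the mediating morphism
-- would pull the fresh top state back to a top state of the colimit.

open import Defs
open import Relation.Nullary using (¬_)
open import Relation.Nullary.Decidable using (dec-true; dec-false)
open import Relation.Binary.PropositionalEquality
open import Data.Nat using (ℕ; suc; _≤_; _≤?_)
open import Data.Nat.Properties using (<-irrefl)
open import Data.Product using (Σ; _,_; proj₁; proj₂)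
open import Data.Sum using (_⊎_; inj₁; inj₂)
open import Data.Unit using (⊤; tt)
open import Data.Empty using (⊥-elim)
open import Data.List using (tabulate)
open import Data.List.Extrema.Nat using (max; xs≤max)
open import Data.List.Relation.Unary.All.Properties using (tabulate⁻)
open import Function.Bundles using (Inverse)

module Tops (Sig : Set) (𝟙 : Sig) where
  open ChuTheory Sig

  IsTop : (C : Chu) → St C → Set
  IsTop C s = ∀ p → r C p s ≡ 𝟙

  HasTop : Chu → Set
  HasTop C = Σ (St C) (IsTop C)

  module _ {C D : Chu} (φ : Hom C D) where

    isTop-pullback : ∀ {y} → (∀ a → r D (f⁺ φ a) y ≡ 𝟙) → IsTop C (f⁻ φ y)
    isTop-pullback top a = trans (sym (adj φ a _)) (top a)

    Hom⇒¬HasTop : ¬ HasTop C → ¬ HasTop D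
    Hom⇒¬HasTop noTop (y , top) = noTop (f⁻ φ y , isTop-pullback (λ a → top (f⁺ φ a)))

  isTop-unique : {C : Chu} → Extensional C → ∀ {s t} → IsTop C s → IsTop C t → s ≡ t
  isTop-unique ext {s} {t} top-s top-t = ext s t (λ p → trans (top-s p) (sym (top-t p)))

  addTop : Chu → Chu
  addTop C = chu (Pt C) (St C ⊎ ⊤) λ where
    p (inj₁ s) → r C p s
    p (inj₂ _) → 𝟙

  addTop-extensional : {C : Chu} → Extensional C → ¬ HasTop C → Extensional (addTop C)
  addTop-extensional ext noTop (inj₁ x) (inj₁ y) eq = cong inj₁ (ext x y eq)
  addTop-extensional ext noTop (inj₁ x) (inj₂ _) eq = ⊥-elim (noTop (x , eq))
  addTop-extensional ext noTop (inj₂ _) (inj₁ y) eq = ⊥-elim (noTop (y , λ p → sym (eq p)))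
  addTop-extensional ext noTop (inj₂ _) (inj₂ _) eq = refl

  module AddTopCocone (S : Seq) (ext : ∀ i → Extensional (obj S i))
                      (tops : ∀ i → HasTop (obj S i)) (c : Cocone S) where

    legSt : ∀ i → St (addTop (apex c)) → St (obj S i)
    legSt i (inj₁ s) = f⁻ (leg c i) s
    legSt i (inj₂ _) = proj₁ (tops i)

    legAdj : ∀ i a y → r (addTop (apex c)) (f⁺ (leg c i) a) y ≡ r (obj S i) a (legSt i y)
    legAdj i a (inj₁ s) = adj (leg c i) a s
    legAdj i a (inj₂ _) = sym (proj₂ (tops i) a)

    addTopLeg : ∀ i → Hom (obj S i) (addTop (apex c))
    addTopLeg i = hom (f⁺ (leg c i)) (legSt i) (legAdj i)

    legSt-comm : ∀ i y → f⁻ (map S i) (legSt (suc i) y) ≡ legSt i y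
    legSt-comm i (inj₁ s) = proj₂ (comm c i) s
    legSt-comm i (inj₂ _) =
      isTop-unique (ext i) (isTop-pullback (map S i) (λ a → proj₂ (tops (suc i)) (f⁺ (map S i) a)))
                           (proj₂ (tops i))

    addTopCocone : Cocone S
    addTopCocone = record
      { apex = addTop (apex c)
      ; leg  = addTopLeg
      ; comm = λ i → proj₁ (comm c i) , legSt-comm i
      }

    addTopLeg-MonoE : ∀ i → MonoE (leg c i) → MonoE (addTopLeg i)
    addTopLeg-MonoE i mono B extB g h (eq⁺ , eq⁻) = mono B extB g h (eq⁺ , λ s → eq⁻ (inj₁ s))

  colimitᵢₑ-¬¬HasTop : (S : Seq) (c : Cocone S) → IsColimit catiE S c →
                       (∀ i → HasTop (obj S i)) → ¬ ¬ HasTop (apex c)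
  colimitᵢₑ-¬¬HasTop S c ((extS , _) , (lift₁ extA , legs-mono) , universal) tops noTop =
    noTop (f⁻ u (inj₂ tt) , λ p → sym (adj u p (inj₂ tt)))
    where
      open AddTopCocone S (λ i → Lift₁.lower₁ (extS i)) tops c
      u = proj₁ (universal addTopCocone
                  ( lift₁ (addTop-extensional extA noTop)
                  , λ i → addTopLeg-MonoE i (legs-mono i)))

module LeqChu (Sig : Set) (𝟘 𝟙 : Sig) where
  open ChuTheory Sig
  open Tops Sig 𝟙

  ℕ≤ : Chu
  ℕ≤ = leqChu Sig 𝟘 𝟙

  r-≤ : ∀ {a x} → a ≤ x → r ℕ≤ a x ≡ 𝟙
  r-≤ {a} {x} a≤x rewrite dec-true (a ≤? x) a≤x = refl

  r-suc : ∀ x → r ℕ≤ (suc x) x ≡ 𝟘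
  r-suc x rewrite dec-false (suc x ≤? x) (<-irrefl refl) = refl

  ¬HasTop : ¬ 𝟘 ≡ 𝟙 → ¬ HasTop ℕ≤
  ¬HasTop 𝟘≢𝟙 (x , top) = 𝟘≢𝟙 (trans (sym (r-suc x)) (top (suc x)))

  finite-bounded : {A : Set} → FiniteSet A → (h : A → ℕ) → Σ ℕ λ n → ∀ a → h a ≤ n
  finite-bounded (k , A↔) h = max 0 hs , λ a →
      subst (λ b → h b ≤ max 0 hs) (Inverse.strictlyInverseˡ A↔ a)
            (tabulate⁻ (xs≤max 0 hs) (Inverse.from A↔ a))
    where hs = tabulate (λ i → h (Inverse.to A↔ i))

  finite-Hom⇒HasTop : {F : Chu} → FiniteSet (Pt F) → Hom F ℕ≤ → HasTop F
  finite-Hom⇒HasTop finPt φ with finite-bounded finPt (f⁺ φ)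
  ... | n , bound = f⁻ φ n , isTop-pullback φ (λ a → r-≤ (bound a))

mainTheorem16 : (Sig : Set) (𝟘 𝟙 : Sig) → ¬ (𝟘 ≡ 𝟙) →
    ¬ ChuTheory.Bifinite Sig (leqChu Sig 𝟘 𝟙)
mainTheorem16 Sig 𝟘 𝟙 𝟘≢𝟙 (S , strongly-finite , _ , c , colimit , (f , g , _)) =
  colimitᵢₑ-¬¬HasTop S c colimit stageTop (Hom⇒¬HasTop f (¬HasTop 𝟘≢𝟙))
  where
    open ChuTheory Sig
    open Tops Sig 𝟙
    open LeqChu Sig 𝟘 𝟙
    stageTop : ∀ i → HasTop (obj S i)
    stageTop i = finite-Hom⇒HasTop (proj₁ (proj₂ (strongly-finite i))) (g ∘H leg c i)
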